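{- Let $\{(V_i,<_i):i\in I\}$ be a track layout of a graph $G$, let $L\subseteq I$ be a set of tracks, and let $S$ be a set of cliques of $G$ each of which covers exactly $L$. Then $S$ is nicely ordered by the track layout.
   Context: A track layout of $G$ is a partition $\{V_i:i\in I\}$ of $V(G)$ with no edge inside a class, with a total order $<_i$ on each $V_i$, such that there are no edges $vw$, $xy$ with $v,x\in V_i$, $w,y\in V_j$, $i\ne j$, $v<_i x$, $y<_j w$. A clique $C$ covers the set of tracks $\{i\in I: C\cap V_i\ne\emptyset\}$. A set $S$ of cliques is nicely ordered by the track layout if there is a total order $\preceq$ on $S$ such that for all $C_1,C_2\in S$, whenever there are a track $i$ and vertices $v\in V_i\cap C_1$, $w\in V_i\cap C_2$ with $v<_i w$, we have $C_1\prec C_2$. -}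

module Defs where

open import Level using (0ℓ)
open import Data.Nat using (ℕ)
open import Data.Fin using (Fin)
open import Data.Fin.Subset using (Subset; _∈_)
open import Data.List using (List)
open import Data.List.Membership.Propositional renaming (_∈_ to _∈ˡ_)
open import Data.Product using (Σ; ∃; _×_)
open import Data.Sum using (_⊎_)
open import Data.Empty using (⊥)
open import Relation.Nullary using (¬_)
open import Relation.Binary.PropositionalEquality using (_≡_; _≢_)
open import Function.Bundles using (_⇔_)

record Graph (n : ℕ) : Set₁ where
  field
    Adj    : Fin n → Fin n → Set
    sym    : ∀ {v w} → Adj v w → Adj w v
    irrefl : ∀ {v} → ¬ Adj v v
open Graph public

-- The partition {V_i} is given by the map track : V → I (V_i = track⁻¹(i)),
-- and the orders <_i are given by a single relation _<ₜ_ that only relates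
-- vertices on the same track and is a strict total order on each track.
record TrackLayout {n : ℕ} (G : Graph n) (I : Set) : Set₁ where
  field
    track    : Fin n → I
    _<ₜ_     : Fin n → Fin n → Set
    <-sameTrack : ∀ {v w} → v <ₜ w → track v ≡ track w
    <-irrefl : ∀ {v} → ¬ (v <ₜ v)
    <-trans  : ∀ {u v w} → u <ₜ v → v <ₜ w → u <ₜ w
    <-total  : ∀ {v w} → track v ≡ track w → v ≢ w → (v <ₜ w) ⊎ (w <ₜ v)
    noEdgeInTrack : ∀ {v w} → Adj G v w → track v ≢ track w
    noCrossing : ∀ {v w x y} → Adj G v w → Adj G x y →
                 track v ≡ track x → track w ≡ track y → track v ≢ track w →
                 v <ₜ x → y <ₜ w → ⊥
open TrackLayout public

IsClique : ∀ {n} → Graph n → Subset n → Set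
IsClique G C = ∀ {v w} → v ∈ C → w ∈ C → v ≢ w → Adj G v w

CoversExactly : ∀ {n} {G : Graph n} {I : Set} → TrackLayout G I →
                (I → Set) → Subset n → Set
CoversExactly T L C = ∀ i → (L i ⇔ ∃ λ v → v ∈ C × track T v ≡ i)

NicelyOrdered : ∀ {n} {G : Graph n} {I : Set} → TrackLayout G I →
                List (Subset n) → Set₁
NicelyOrdered {n} T S =
  Σ (Subset n → Subset n → Set) λ _⪯_ →
    (∀ {C} → C ∈ˡ S → C ⪯ C)
  × (∀ {C₁ C₂} → C₁ ∈ˡ S → C₂ ∈ˡ S → C₁ ⪯ C₂ → C₂ ⪯ C₁ → C₁ ≡ C₂)
  × (∀ {C₁ C₂ C₃} → C₁ ∈ˡ S → C₂ ∈ˡ S → C₃ ∈ˡ S → C₁ ⪯ C₂ → C₂ ⪯ C₃ → C₁ ⪯ C₃)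
  × (∀ {C₁ C₂} → C₁ ∈ˡ S → C₂ ∈ˡ S → (C₁ ⪯ C₂) ⊎ (C₂ ⪯ C₁))
  × (∀ {C₁ C₂ v w} → C₁ ∈ˡ S → C₂ ∈ˡ S → v ∈ C₁ → w ∈ C₂ →
       track T v ≡ track T w → _<ₜ_ T v w → (C₁ ⪯ C₂) × (C₁ ≢ C₂))

{-# OPTIONS --safe #-}
module Submission where

-- Say that a clique C precedes a clique D, written C ◁ D, if some track carries a
-- vertex of C before a vertex of D.  A clique meets every track at most once, so if
-- C ◁ D and D ◁ C held together, the two witnessing pairs would either lie on one
-- track (forcing a vertex to precede itself) or on two tracks, where the edges they
-- span inside C and D cross.  Hence ◁ is asymmetric, and it is irreflexive on
-- cliques.  When all cliques cover the same tracks, a vertex of C can be compared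
-- with the vertex of any other clique on its own track: this makes ◁ transitive, and
-- two distinct cliques, which differ in a vertex, are comparable.  So "C ≡ D or C ◁
-- D" is a nice order.

open import Defs using (Graph; TrackLayout; IsClique; CoversExactly; NicelyOrdered)
open import Data.Nat using (ℕ)
open import Data.Fin using (_≟_)
open import Data.Fin.Properties using (any?)
open import Data.Fin.Subset using (Subset; _∈_; _∉_; _⊆_)
open import Data.Fin.Subset.Properties using (_∈?_; ⊆-antisym)
open import Data.List using (List)
open import Data.List.Membership.Propositional using () renaming (_∈_ to _∈ˡ_)
open import Data.List.Relation.Unary.All using (All)
import Data.List.Relation.Unary.All as All
open import Data.Product using (_×_; ∃; ∃₂; _,_; proj₁; proj₂)
open import Data.Sum using (_⊎_; inj₁; inj₂)
open import Function using (_∘_)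
open import Function.Bundles using (Equivalence)
open import Relation.Nullary using (¬_; yes; no; contradiction)
open import Relation.Nullary.Decidable using (decidable-stable; ¬?; _×-dec_)
open import Relation.Binary.PropositionalEquality using (_≡_; _≢_; refl; sym; trans; cong; subst)

⊆⊎∃∉ : ∀ {n} (C D : Subset n) → C ⊆ D ⊎ ∃ λ v → v ∈ C × v ∉ D
⊆⊎∃∉ C D with any? (λ v → (v ∈? C) ×-dec ¬? (v ∈? D))
... | yes witness = inj₂ witness
... | no ¬witness = inj₁ λ {v} v∈C → decidable-stable (v ∈? D) (λ v∉D → ¬witness (v , v∈C , v∉D))

module _ {n : ℕ} {G : Graph n} {I : Set} (T : TrackLayout G I) where

  open TrackLayout T

  _◁_ : Subset n → Subset n → Set
  C ◁ D = ∃₂ λ v w → v ∈ C × w ∈ D × v <ₜ w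

  _⪯_ : Subset n → Subset n → Set
  C ⪯ D = C ≡ D ⊎ C ◁ D

  _⊆ᵗ_ : Subset n → Subset n → Set
  C ⊆ᵗ D = ∀ {v} → v ∈ C → ∃ λ u → u ∈ D × track u ≡ track v

  coversExactly⇒⊆ᵗ : ∀ {L C D} → CoversExactly T L C → CoversExactly T L D → C ⊆ᵗ D
  coversExactly⇒⊆ᵗ coversC coversD {v} v∈C =
    Equivalence.to (coversD (track v)) (Equivalence.from (coversC (track v)) (v , v∈C , refl))

  clique-track-injective : ∀ {C v w} → IsClique G C → v ∈ C → w ∈ C →
                           track v ≡ track w → v ≡ w
  clique-track-injective {v = v} {w} clique v∈C w∈C tv≡tw with v ≟ w
  ... | yes v≡w = v≡w
  ... | no  v≢w = contradiction tv≡tw (noEdgeInTrack (clique v∈C w∈C v≢w))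

  ◁-asym : ∀ {C D} → IsClique G C → IsClique G D → C ◁ D → ¬ D ◁ C
  ◁-asym cliqueC cliqueD (v , v′ , v∈C , v′∈D , v<v′) (w′ , w , w′∈D , w∈C , w′<w) =
    ¬differentTracks ¬sameTrack
    where
    tv≡tv′ : track v ≡ track v′
    tv≡tv′ = <-sameTrack v<v′
    tw′≡tw : track w′ ≡ track w
    tw′≡tw = <-sameTrack w′<w

    ¬sameTrack : ¬ track v ≡ track w
    ¬sameTrack tv≡tw
      with clique-track-injective cliqueC v∈C w∈C tv≡tw
         | clique-track-injective cliqueD v′∈D w′∈D (trans (sym tv≡tv′) (trans tv≡tw (sym tw′≡tw)))
    ... | refl | refl = <-irrefl (<-trans v<v′ w′<w)

    -- The goal is ⊥, so we may split on track v ≡ track w without deciding it.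
    ¬differentTracks : ¬ ¬ track v ≡ track w
    ¬differentTracks tv≢tw =
      noCrossing (cliqueC v∈C w∈C (tv≢tw ∘ cong track)) (cliqueD v′∈D w′∈D v′≢w′)
                 tv≡tv′ (sym tw′≡tw) tv≢tw v<v′ w′<w
      where
      v′≢w′ : v′ ≢ w′
      v′≢w′ v′≡w′ = tv≢tw (trans tv≡tv′ (trans (cong track v′≡w′) tw′≡tw))

  ◁-irrefl : ∀ {C} → IsClique G C → ¬ C ◁ C
  ◁-irrefl clique C◁C = ◁-asym clique clique C◁C C◁C

  ◁-trans : ∀ {C D E} → IsClique G D → IsClique G E → C ⊆ᵗ E → C ◁ D → D ◁ E → C ◁ E
  ◁-trans cliqueD cliqueE C⊆ᵗE (v , w , v∈C , w∈D , v<w) D◁E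
    with C⊆ᵗE v∈C
  ... | u , u∈E , tu≡tv with v ≟ u
  ... | yes refl = contradiction (u , w , u∈E , w∈D , v<w) (◁-asym cliqueD cliqueE D◁E)
  ... | no  v≢u with <-total (sym tu≡tv) v≢u
  ... | inj₁ v<u = v , u , v∈C , u∈E , v<u
  ... | inj₂ u<v = contradiction (u , w , u∈E , w∈D , <-trans u<v v<w) (◁-asym cliqueD cliqueE D◁E)

  ∉⇒◁-connex : ∀ {C D v} → C ⊆ᵗ D → v ∈ C → v ∉ D → C ◁ D ⊎ D ◁ C
  ∉⇒◁-connex C⊆ᵗD v∈C v∉D with C⊆ᵗD v∈C
  ... | u , u∈D , tu≡tv with <-total (sym tu≡tv) (λ v≡u → v∉D (subst (_∈ _) (sym v≡u) u∈D))
  ... | inj₁ v<u = inj₁ (_ , _ , v∈C , u∈D , v<u)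
  ... | inj₂ u<v = inj₂ (_ , _ , u∈D , v∈C , u<v)

  ◁-trichotomous : ∀ {C D} → C ⊆ᵗ D → D ⊆ᵗ C → C ≡ D ⊎ C ◁ D ⊎ D ◁ C
  ◁-trichotomous {C} {D} C⊆ᵗD D⊆ᵗC with ⊆⊎∃∉ C D | ⊆⊎∃∉ D C
  ... | inj₂ (_ , v∈C , v∉D) | _ = inj₂ (∉⇒◁-connex C⊆ᵗD v∈C v∉D)
  ... | inj₁ _ | inj₂ (_ , v∈D , v∉C) with ∉⇒◁-connex D⊆ᵗC v∈D v∉C
  ...   | inj₁ D◁C = inj₂ (inj₂ D◁C)
  ...   | inj₂ C◁D = inj₂ (inj₁ C◁D)
  ◁-trichotomous C⊆ᵗD D⊆ᵗC | inj₁ C⊆D | inj₁ D⊆C = inj₁ (⊆-antisym C⊆D D⊆C)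

  ◁⇒≢ : ∀ {C D} → IsClique G C → C ◁ D → C ≢ D
  ◁⇒≢ clique C◁C refl = ◁-irrefl clique C◁C

  ⪯-antisym : ∀ {C D} → IsClique G C → IsClique G D → C ⪯ D → D ⪯ C → C ≡ D
  ⪯-antisym _ _ (inj₁ C≡D) _ = C≡D
  ⪯-antisym _ _ (inj₂ _) (inj₁ D≡C) = sym D≡C
  ⪯-antisym cliqueC cliqueD (inj₂ C◁D) (inj₂ D◁C) = contradiction D◁C (◁-asym cliqueC cliqueD C◁D)

  ⪯-trans : ∀ {C D E} → IsClique G D → IsClique G E → C ⊆ᵗ E → C ⪯ D → D ⪯ E → C ⪯ E
  ⪯-trans _ _ _ (inj₁ refl) D⪯E = D⪯E
  ⪯-trans _ _ _ (inj₂ C◁D) (inj₁ refl) = inj₂ C◁D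
  ⪯-trans cliqueD cliqueE C⊆ᵗE (inj₂ C◁D) (inj₂ D◁E) = inj₂ (◁-trans cliqueD cliqueE C⊆ᵗE C◁D D◁E)

  ⪯-total : ∀ {C D} → C ⊆ᵗ D → D ⊆ᵗ C → C ⪯ D ⊎ D ⪯ C
  ⪯-total C⊆ᵗD D⊆ᵗC with ◁-trichotomous C⊆ᵗD D⊆ᵗC
  ... | inj₁ C≡D        = inj₁ (inj₁ C≡D)
  ... | inj₂ (inj₁ C◁D) = inj₁ (inj₂ C◁D)
  ... | inj₂ (inj₂ D◁C) = inj₂ (inj₂ D◁C)

lemma7p1 : (n : ℕ) (G : Graph n) (I : Set) (T : TrackLayout G I)
    (L : I → Set) (S : List (Subset n)) →
    All (λ C → IsClique G C × CoversExactly T L C) S →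
    NicelyOrdered T S
lemma7p1 n G I T L S cliques =
    _⪯_ T
  , (λ _ → inj₁ refl)
  , (λ C∈S D∈S → ⪯-antisym T (clique C∈S) (clique D∈S))
  , (λ C∈S D∈S E∈S → ⪯-trans T (clique D∈S) (clique E∈S) (sameTracks C∈S E∈S))
  , (λ C∈S D∈S → ⪯-total T (sameTracks C∈S D∈S) (sameTracks D∈S C∈S))
  , λ C∈S _ v∈C w∈D _ v<w → let C◁D = (_ , _ , v∈C , w∈D , v<w) in
      inj₂ C◁D , ◁⇒≢ T (clique C∈S) C◁D
  where
  clique : ∀ {C} → C ∈ˡ S → IsClique G C
  clique = proj₁ ∘ All.lookup cliques

  sameTracks : ∀ {C D} → C ∈ˡ S → D ∈ˡ S → _⊆ᵗ_ T C D
  sameTracks C∈S D∈S =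
    coversExactly⇒⊆ᵗ T (proj₂ (All.lookup cliques C∈S)) (proj₂ (All.lookup cliques D∈S))
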